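{- Let $G$ be a tree and let $\Delta(G)$ denote its maximum degree. Then $$\frac{i(G)}{\gamma(G)} \leq \begin{cases} 1, & \text{if } \Delta(G)\le 2,\\[2pt] \dfrac{\Delta(G)}{2}, & \text{if } \Delta(G)\ge 3,\end{cases}$$ and equality holds if either $\Delta(G)\le 2$ or $G$ is a balanced double star.
   Context: All graphs are finite, simple and undirected. A set $D\subseteq V(G)$ is a dominating set if every vertex of $V(G)\setminus D$ is adjacent to some vertex of $D$; the domination number $\gamma(G)$ is the minimum cardinality of a dominating set. An independent dominating set is a dominating set that is also an independent set (no two of its vertices are adjacent); the independent domination number $i(G)$ is the minimum cardinality of an independent dominating set. A tree is a connected graph with no cycles. A double star is a tree with exactly two vertices of degree greater than $1$; it is a balanced double star if these two vertices have the same degree. -}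

module Defs where

open import Data.Nat using (ℕ; zero; suc; _+_; _*_; _≤_; _<_; _⊔_)
open import Data.Bool using (Bool; true; false; if_then_else_)
open import Data.Fin using (Fin; zero; suc; inject₁; fromℕ)
open import Data.Fin.Subset using (Subset; _∈_; _∉_; ∣_∣)
open import Data.List using (List; foldr; map; length; filter)
open import Data.List using () renaming (allFin to allFinL)
open import Data.Product using (Σ; ∃; ∃-syntax; _×_; _,_)
open import Data.Sum using (_⊎_)
open import Relation.Nullary using (¬_)
open import Relation.Binary.PropositionalEquality using (_≡_; _≢_)
open import Function.Definitions using (Injective)

record Graph (n : ℕ) : Set where
  field
    adj    : Fin n → Fin n → Bool
    sym    : ∀ u v → adj u v ≡ adj v u
    irrefl : ∀ v → adj v v ≡ false

module _ {n : ℕ} (G : Graph n) where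
  open Graph G

  Adj : Fin n → Fin n → Set
  Adj u v = adj u v ≡ true

  degree : Fin n → ℕ
  degree v = foldr (λ w acc → if adj v w then suc acc else acc) 0 (allFinL n)

  maxDegree : ℕ
  maxDegree = foldr (λ v acc → degree v ⊔ acc) 0 (allFinL n)

  data Walk : Fin n → Fin n → Set where
    here : ∀ {u} → Walk u u
    step : ∀ {u w v} → Adj u w → Walk w v → Walk u v

  Connected : Set
  Connected = ∀ u v → Walk u v

  HasCycle : Set
  HasCycle = Σ ℕ λ k → Σ (Fin (suc (suc (suc k))) → Fin n) λ c →
    Injective _≡_ _≡_ c ×
    (∀ (i : Fin (suc (suc k))) → Adj (c (inject₁ i)) (c (suc i))) ×
    Adj (c (fromℕ (suc (suc k)))) (c zero)

  IsTree : Set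
  IsTree = 1 ≤ n × Connected × ¬ HasCycle

  IsBalancedDoubleStar : Set
  IsBalancedDoubleStar = Σ (Fin n) λ u → Σ (Fin n) λ v →
    u ≢ v × 1 < degree u × 1 < degree v × degree u ≡ degree v ×
    (∀ w → 1 < degree w → w ≡ u ⊎ w ≡ v)

  IsDominating : Subset n → Set
  IsDominating D = ∀ v → v ∉ D → Σ (Fin n) λ u → u ∈ D × Adj u v

  IsIndependent : Subset n → Set
  IsIndependent D = ∀ u v → u ∈ D → v ∈ D → ¬ Adj u v

  IsDominationNumber : ℕ → Set
  IsDominationNumber m =
    (Σ (Subset n) λ D → IsDominating D × ∣ D ∣ ≡ m) ×
    (∀ D → IsDominating D → m ≤ ∣ D ∣)

  IsIndependentDominationNumber : ℕ → Set
  IsIndependentDominationNumber m =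
    (Σ (Subset n) λ D → IsDominating D × IsIndependent D × ∣ D ∣ ≡ m) ×
    (∀ D → IsDominating D → IsIndependent D → m ≤ ∣ D ∣)

module Submission where

-- Let D be a minimum dominating set of the tree. Since a forest has a vertex with at most
-- one neighbour inside any given vertex set, D contains an independent set S with |D| ≤ 2|S|.
-- Starting from S, treat the vertices x of D ─ S one at a time: if x is not yet dominated
-- add x, otherwise add the neighbours of x that are not yet dominated. There are at most
-- Δ − 1 of them (x lies in the set or has a neighbour in it), and as a tree has no triangles
-- the set stays independent. Hence i ≤ |S| + (Δ − 1)|D ─ S| ≤ Δγ/2, and i ≤ |D| = γ when
-- Δ ≤ 2. In a balanced double star with centres of degree d we have γ = 2 and Δ = d; an
-- independent dominating set misses some centre, so it contains that centre's d − 1 leaves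
-- and a dominator of the other centre, whence i = d.

open import Defs
open import Data.Bool using (Bool; true; false; if_then_else_)
open import Data.Bool.Properties using () renaming (_≟_ to _≟ᵇ_)
open import Data.Empty using (⊥; ⊥-elim)
open import Data.Fin using (Fin; zero; suc; toℕ; inject₁; fromℕ; _≟_)
open import Data.Fin.Properties using (any?; pigeonhole; toℕ<n; toℕ-injective; toℕ-inject₁; toℕ-fromℕ)
open import Data.Fin.Subset renaming (⊥ to ∅)
open import Data.Fin.Subset.Properties
open import Data.Fin.Subset.Induction using (⊂-wellFounded)
open import Data.List using (List; []; _∷_; foldr)
open import Data.List.Membership.Propositional using () renaming (_∈_ to _∈ˡ_)
open import Data.List.Membership.Propositional.Properties using (∈-allFin)
open import Data.List.Relation.Unary.Any using () renaming (here to hereˡ; there to thereˡ)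
open import Data.Nat using (ℕ; zero; suc; _+_; _*_; _∸_; _≤_; _<_; _⊔_; z≤n; s≤s)
open import Data.Nat.Tactic.RingSolver using (solve-∀)
open import Data.Nat.Properties hiding (_≟_)
open import Data.Product using (Σ; ∃; _×_; _,_; proj₁; proj₂)
open import Data.Sum using (_⊎_; inj₁; inj₂; [_,_]′; swap)
open import Data.Vec using ([]; _∷_; tabulate; here; there)
open import Data.Vec.Properties using (lookup∘tabulate; []=⇒lookup; lookup⇒[]=)
open import Function using (_∘_)
open import Induction.WellFounded using (Acc; acc)
open import Relation.Nullary using (¬_; Dec; yes; no; does; contradiction)
open import Relation.Nullary.Decidable using (dec-true; ¬?; _×-dec_; _⊎-dec_)
open import Relation.Unary using (Decidable)
open import Relation.Binary using (tri<; tri≈; tri>)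
open import Relation.Binary.PropositionalEquality

private variable
  n : ℕ
  p q : Subset n

2*[s+[Δ∸1]*t]≤Δ*[s+t] : ∀ {Δ s t} → 2 ≤ Δ → t ≤ s → 2 * (s + (Δ ∸ 1) * t) ≤ Δ * (s + t)
2*[s+[Δ∸1]*t]≤Δ*[s+t] {suc (suc c)} {s} {t} (s≤s (s≤s z≤n)) t≤s with r , refl ← m≤n⇒∃[o]m+o≡n t≤s =
  ≤-trans (m≤m+n _ (c * r)) (≤-reflexive (sym (expand t r c)))
  where
  expand : ∀ t r c → suc (suc c) * (t + r + t) ≡ 2 * (t + r + suc c * t) + c * r
  expand = solve-∀

-- Counting in finite subsets

∣p∪q∣≤∣p∣+∣q∣ : ∀ (p q : Subset n) → ∣ p ∪ q ∣ ≤ ∣ p ∣ + ∣ q ∣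
∣p∪q∣≤∣p∣+∣q∣ []            []            = z≤n
∣p∪q∣≤∣p∣+∣q∣ (outside ∷ p) (outside ∷ q) = ∣p∪q∣≤∣p∣+∣q∣ p q
∣p∪q∣≤∣p∣+∣q∣ (outside ∷ p) (inside  ∷ q) =
  ≤-trans (s≤s (∣p∪q∣≤∣p∣+∣q∣ p q)) (≤-reflexive (sym (+-suc ∣ p ∣ ∣ q ∣)))
∣p∪q∣≤∣p∣+∣q∣ (inside  ∷ p) (outside ∷ q) = s≤s (∣p∪q∣≤∣p∣+∣q∣ p q)
∣p∪q∣≤∣p∣+∣q∣ (inside  ∷ p) (inside  ∷ q) =
  s≤s (≤-trans (∣p∪q∣≤∣p∣+∣q∣ p q) (+-monoʳ-≤ ∣ p ∣ (n≤1+n ∣ q ∣)))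

p⊆q⇒∣q∣≡∣p∣+∣q─p∣ : p ⊆ q → ∣ q ∣ ≡ ∣ p ∣ + ∣ q ─ p ∣
p⊆q⇒∣q∣≡∣p∣+∣q─p∣ {p = []}          {[]}          _   = refl
p⊆q⇒∣q∣≡∣p∣+∣q─p∣ {p = outside ∷ p} {outside ∷ q} p⊆q = p⊆q⇒∣q∣≡∣p∣+∣q─p∣ (drop-∷-⊆ p⊆q)
p⊆q⇒∣q∣≡∣p∣+∣q─p∣ {p = outside ∷ p} {inside  ∷ q} p⊆q =
  trans (cong suc (p⊆q⇒∣q∣≡∣p∣+∣q─p∣ (drop-∷-⊆ p⊆q))) (sym (+-suc ∣ p ∣ ∣ q ─ p ∣))
p⊆q⇒∣q∣≡∣p∣+∣q─p∣ {p = inside  ∷ p} {outside ∷ q} p⊆q = contradiction (p⊆q here) λ ()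
p⊆q⇒∣q∣≡∣p∣+∣q─p∣ {p = inside  ∷ p} {inside  ∷ q} p⊆q = cong suc (p⊆q⇒∣q∣≡∣p∣+∣q─p∣ (drop-∷-⊆ p⊆q))

x∈p─q⇒x∉q : ∀ {x} (p q : Subset n) → x ∈ p ─ q → x ∉ q
x∈p─q⇒x∉q (inside ∷ p) (outside ∷ q) here       ()
x∈p─q⇒x∉q (_      ∷ p) (_       ∷ q) (there x∈) (there x∈q) = x∈p─q⇒x∉q p q x∈ x∈q

x∈p-y⇒x≢y : ∀ {x y} (p : Subset n) → x ∈ p - y → x ≢ y
x∈p-y⇒x≢y {y = y} p x∈ = x∉⁅y⁆⇒x≢y (x∈p─q⇒x∉q p ⁅ y ⁆ x∈)

x∈p⇒⁅x⁆⊆p : ∀ {x} → x ∈ p → ⁅ x ⁆ ⊆ p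
x∈p⇒⁅x⁆⊆p {x = x} x∈p y∈⁅x⁆ rewrite x∈⁅y⁆⇒x≡y x y∈⁅x⁆ = x∈p

x∈p⇒0<∣p∣ : ∀ {x} → x ∈ p → 0 < ∣ p ∣
x∈p⇒0<∣p∣ {x = x} x∈p = subst (_≤ _) (∣⁅x⁆∣≡1 x) (p⊆q⇒∣p∣≤∣q∣ (x∈p⇒⁅x⁆⊆p x∈p))

0<∣p∣⇒nonempty : ∀ {n} {p : Subset n} → 0 < ∣ p ∣ → Nonempty p
0<∣p∣⇒nonempty {n = n} {p = p} 0<∣p∣ with nonempty? p
... | yes ne = ne
... | no ¬ne = contradiction (trans (cong ∣_∣ (Empty-unique ¬ne)) (∣⊥∣≡0 n)) (>⇒≢ 0<∣p∣)

∣p∣≤1+∣p-x∣ : ∀ (p : Subset n) x → ∣ p ∣ ≤ suc ∣ p - x ∣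
∣p∣≤1+∣p-x∣ p x = begin
  ∣ p ∣                 ≤⟨ p⊆q⇒∣p∣≤∣q∣ p⊆⁅x⁆∪[p-x] ⟩
  ∣ ⁅ x ⁆ ∪ (p - x) ∣   ≤⟨ ∣p∪q∣≤∣p∣+∣q∣ ⁅ x ⁆ (p - x) ⟩
  ∣ ⁅ x ⁆ ∣ + ∣ p - x ∣ ≡⟨ cong (_+ ∣ p - x ∣) (∣⁅x⁆∣≡1 x) ⟩
  suc ∣ p - x ∣         ∎
  where
  open ≤-Reasoning
  p⊆⁅x⁆∪[p-x] : p ⊆ ⁅ x ⁆ ∪ (p - x)
  p⊆⁅x⁆∪[p-x] {y} y∈p with y ≟ x
  ... | yes refl = p⊆p∪q (p - x) (x∈⁅x⁆ x)
  ... | no y≢x   = q⊆p∪q ⁅ x ⁆ (p - x) (x∈p∧x≢y⇒x∈p-y y∈p y≢x)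

two-elements⇒2≤∣p∣ : ∀ {x y} → x ∈ p → y ∈ p → x ≢ y → 2 ≤ ∣ p ∣
two-elements⇒2≤∣p∣ x∈p y∈p x≢y =
  ≤-trans (s≤s (x∈p⇒0<∣p∣ (x∈p∧x≢y⇒x∈p-y y∈p (x≢y ∘ sym)))) (x∈p⇒∣p-x∣<∣p∣ x∈p)

1<∣p∣⇒element≢ : ∀ {p : Subset n} → 1 < ∣ p ∣ → ∀ y → ∃ λ x → x ∈ p × x ≢ y
1<∣p∣⇒element≢ {p = p} 1<∣p∣ y with 0<∣p∣⇒nonempty (≤-pred (≤-trans 1<∣p∣ (∣p∣≤1+∣p-x∣ p y)))
... | x , x∈p-y = x , p─q⊆p p ⁅ y ⁆ x∈p-y , x∈p-y⇒x≢y p x∈p-y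

⟦_⟧ : {P : Fin n → Set} → Decidable P → Subset n
⟦ P? ⟧ = tabulate (does ∘ P?)

∈⟦⟧⁺ : ∀ {P : Fin n → Set} (P? : Decidable P) {x} → P x → x ∈ ⟦ P? ⟧
∈⟦⟧⁺ P? {x} px = lookup⇒[]= x _ (trans (lookup∘tabulate _ x) (dec-true (P? x) px))

∈⟦⟧⁻ : ∀ {P : Fin n → Set} (P? : Decidable P) {x} → x ∈ ⟦ P? ⟧ → P x
∈⟦⟧⁻ P? {x} x∈ with P? x | trans (sym (lookup∘tabulate _ x)) ([]=⇒lookup x∈)
... | yes px | _ = px
... | no _   | ()

foldr-count≡∣tabulate∣ : ∀ {A : Set} (f : A → Bool) (g : Fin n → A) →
  foldr (λ a k → if f a then suc k else k) 0 (Data.List.tabulate g) ≡ ∣ tabulate (f ∘ g) ∣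
foldr-count≡∣tabulate∣ {n = zero}  f g = refl
foldr-count≡∣tabulate∣ {n = suc n} f g with f (g zero)
... | true  = cong suc (foldr-count≡∣tabulate∣ f (g ∘ suc))
... | false = foldr-count≡∣tabulate∣ f (g ∘ suc)

foldr-⊔-upper : ∀ {A : Set} (f : A → ℕ) {a : A} {as : List A} →
  a ∈ˡ as → f a ≤ foldr (λ b k → f b ⊔ k) 0 as
foldr-⊔-upper f (hereˡ refl) = m≤m⊔n _ _
foldr-⊔-upper f (thereˡ a∈as) = ≤-trans (foldr-⊔-upper f a∈as) (m≤n⊔m _ _)

foldr-⊔-least : ∀ {A : Set} (f : A → ℕ) {B : ℕ} → (∀ a → f a ≤ B) →
  ∀ (as : List A) → foldr (λ b k → f b ⊔ k) 0 as ≤ B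
foldr-⊔-least f f≤B []       = z≤n
foldr-⊔-least f f≤B (a ∷ as) = ⊔-lub (f≤B a) (foldr-⊔-least f f≤B as)

module _ (G : Graph n) where
  open Graph G using (adj)

  N : Fin n → Subset n
  N v = tabulate (adj v)

  ∈N⁺ : ∀ {v w} → Adj G v w → w ∈ N v
  ∈N⁺ {v} {w} vw = lookup⇒[]= w (N v) (trans (lookup∘tabulate (adj v) w) vw)

  ∈N⁻ : ∀ {v w} → w ∈ N v → Adj G v w
  ∈N⁻ {v} {w} w∈Nv = trans (sym (lookup∘tabulate (adj v) w)) ([]=⇒lookup w∈Nv)

  degree≡∣N∣ : ∀ v → degree G v ≡ ∣ N v ∣
  degree≡∣N∣ v = foldr-count≡∣tabulate∣ (adj v) (λ w → w)

  degree≤maxDegree : ∀ v → degree G v ≤ maxDegree G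
  degree≤maxDegree v = foldr-⊔-upper (degree G) (∈-allFin v)

  maxDegree≤ : ∀ {B} → (∀ v → degree G v ≤ B) → maxDegree G ≤ B
  maxDegree≤ degree≤B = foldr-⊔-least (degree G) degree≤B (Data.List.allFin n)

  Adj-sym : ∀ {u v} → Adj G u v → Adj G v u
  Adj-sym {u} {v} uv = trans (Graph.sym G v u) uv

  Adj-irrefl : ∀ {v} → ¬ Adj G v v
  Adj-irrefl {v} vv with () ← trans (sym vv) (Graph.irrefl G v)

  Adj⇒≢ : ∀ {u v} → Adj G u v → u ≢ v
  Adj⇒≢ uv refl = Adj-irrefl uv

  adj? : ∀ u v → Dec (Adj G u v)
  adj? u v = adj u v ≟ᵇ true

  degree≤1⇒neighbours-equal : ∀ {w a b} → degree G w ≤ 1 → Adj G w a → Adj G w b → a ≡ b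
  degree≤1⇒neighbours-equal {w} {a} {b} deg≤1 wa wb with a ≟ b
  ... | yes a≡b = a≡b
  ... | no a≢b  = contradiction (subst (2 ≤_) (sym (degree≡∣N∣ w))
                    (two-elements⇒2≤∣p∣ (∈N⁺ wa) (∈N⁺ wb) a≢b)) (<⇒≱ (s≤s deg≤1))

  1<degree⇒neighbour≢ : ∀ {w} → 1 < degree G w → ∀ y → ∃ λ x → Adj G w x × x ≢ y
  1<degree⇒neighbour≢ {w} 1<deg y with 1<∣p∣⇒element≢ (subst (1 <_) (degree≡∣N∣ w) 1<deg) y
  ... | x , x∈N , x≢y = x , ∈N⁻ x∈N , x≢y

  _∈N[_] : Fin n → Fin n → Set
  w ∈N[ v ] = w ≡ v ⊎ Adj G v w

  Dominated : Subset n → Fin n → Set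
  Dominated I w = ∃ λ v → v ∈ I × w ∈N[ v ]

  dominated? : ∀ I w → Dec (Dominated I w)
  dominated? I w = any? (λ v → v ∈? I ×-dec (w ≟ v ⊎-dec adj? v w))

  Dominated-mono : ∀ {I J w} → I ⊆ J → Dominated I w → Dominated J w
  Dominated-mono I⊆J (v , v∈I , w∈N[v]) = v , I⊆J v∈I , w∈N[v]

  dominating⇒dominated : ∀ {D} → IsDominating G D → ∀ w → Dominated D w
  dominating⇒dominated {D} D-dom w with w ∈? D
  ... | yes w∈D = w , w∈D , inj₁ refl
  ... | no  w∉D with D-dom w w∉D
  ...   | v , v∈D , vw = v , v∈D , inj₂ vw

  dominated⇒dominating : ∀ {D} → (∀ w → Dominated D w) → IsDominating G D
  dominated⇒dominating all-dominated w w∉D with all-dominated w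
  ... | v , v∈D , inj₁ refl = contradiction v∈D w∉D
  ... | v , v∈D , inj₂ vw   = v , v∈D , vw

  independent-∪ : ∀ {I J} → IsIndependent G I → IsIndependent G J →
    (∀ a b → a ∈ I → b ∈ J → ¬ Adj G a b) → IsIndependent G (I ∪ J)
  independent-∪ {I} {J} I-ind J-ind I≁J a b a∈ b∈ ab
    with x∈p∪q⁻ I J a∈ | x∈p∪q⁻ I J b∈
  ... | inj₁ a∈I | inj₁ b∈I = I-ind a b a∈I b∈I ab
  ... | inj₁ a∈I | inj₂ b∈J = I≁J a b a∈I b∈J ab
  ... | inj₂ a∈J | inj₁ b∈I = I≁J b a b∈I a∈J (Adj-sym ab)
  ... | inj₂ a∈J | inj₂ b∈J = J-ind a b a∈J b∈J ab

  independent-⁅⁆ : ∀ x → IsIndependent G ⁅ x ⁆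
  independent-⁅⁆ x a b a∈ b∈ ab
    rewrite x∈⁅y⁆⇒x≡y x a∈ | x∈⁅y⁆⇒x≡y x b∈ = Adj-irrefl ab

  independent-∅ : IsIndependent G ∅
  independent-∅ a b a∈∅ = contradiction a∈∅ ∉⊥

  TriangleFree : Set
  TriangleFree = ∀ {x y z} → Adj G x y → Adj G y z → Adj G z x → ⊥

  acyclic⇒triangle-free : ¬ HasCycle G → TriangleFree
  acyclic⇒triangle-free acyclic {x} {y} {z} xy yz zx = acyclic (0 , c , c-injective , c-path , zx)
    where
    c : Fin 3 → Fin n
    c zero             = x
    c (suc zero)       = y
    c (suc (suc zero)) = z
    c-path : ∀ (i : Fin 2) → Adj G (c (inject₁ i)) (c (suc i))
    c-path zero       = xy
    c-path (suc zero) = yz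
    c-injective : ∀ {i j} → c i ≡ c j → i ≡ j
    c-injective {zero}             {zero}             _ = refl
    c-injective {zero}             {suc zero}       x≡y = contradiction x≡y (Adj⇒≢ xy)
    c-injective {zero}             {suc (suc zero)} x≡z = contradiction (sym x≡z) (Adj⇒≢ zx)
    c-injective {suc zero}         {zero}           y≡x = contradiction (sym y≡x) (Adj⇒≢ xy)
    c-injective {suc zero}         {suc zero}         _ = refl
    c-injective {suc zero}         {suc (suc zero)} y≡z = contradiction y≡z (Adj⇒≢ yz)
    c-injective {suc (suc zero)}   {zero}           z≡x = contradiction z≡x (Adj⇒≢ zx)
    c-injective {suc (suc zero)}   {suc zero}       z≡y = contradiction (sym z≡y) (Adj⇒≢ yz)
    c-injective {suc (suc zero)}   {suc (suc zero)}   _ = refl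

  -- Greedy extension to an independent dominating set

  Covers : Subset n → Fin n → Set
  Covers I x = ∀ {w} → w ∈N[ x ] → Dominated I w

  module _ (triangle-free : TriangleFree) {B : ℕ} (1≤B : 1 ≤ B)
           (degree≤1+B : ∀ v → degree G v ≤ suc B) where

    extend-at : ∀ x I → IsIndependent G I →
      ∃ λ I′ → I ⊆ I′ × IsIndependent G I′ × ∣ I′ ∣ ≤ ∣ I ∣ + B × Covers I′ x
    extend-at x I I-ind with dominated? I x
    ... | no x-undominated = I ∪ ⁅ x ⁆ , p⊆p∪q ⁅ x ⁆ , ind , size , covers
      where
      ind : IsIndependent G (I ∪ ⁅ x ⁆)
      ind = independent-∪ I-ind (independent-⁅⁆ x) λ a b a∈I b∈⁅x⁆ ab →
        x-undominated (a , a∈I , inj₂ (subst (Adj G a) (x∈⁅y⁆⇒x≡y x b∈⁅x⁆) ab))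
      size : ∣ I ∪ ⁅ x ⁆ ∣ ≤ ∣ I ∣ + B
      size = ≤-trans (∣p∪q∣≤∣p∣+∣q∣ I ⁅ x ⁆)
                     (+-monoʳ-≤ ∣ I ∣ (subst (_≤ B) (sym (∣⁅x⁆∣≡1 x)) 1≤B))
      covers : Covers (I ∪ ⁅ x ⁆) x
      covers w∈N[x] = x , q⊆p∪q I ⁅ x ⁆ (x∈⁅x⁆ x) , w∈N[x]
    ... | yes x-dominated = I ∪ U , p⊆p∪q U , ind , size , covers
      where
      fresh? : ∀ w → Dec (Adj G x w × ¬ Dominated I w)
      fresh? w = adj? x w ×-dec ¬? (dominated? I w)
      U : Subset n
      U = ⟦ fresh? ⟧
      ind : IsIndependent G (I ∪ U)
      ind = independent-∪ I-ind U-ind λ a b a∈I b∈U ab →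
        proj₂ (∈⟦⟧⁻ fresh? b∈U) (a , a∈I , inj₂ ab)
        where
        U-ind : IsIndependent G U
        U-ind a b a∈U b∈U ab =
          triangle-free (proj₁ (∈⟦⟧⁻ fresh? a∈U)) ab (Adj-sym (proj₁ (∈⟦⟧⁻ fresh? b∈U)))
      ∣U∣≤B : Dominated I x → ∣ U ∣ ≤ B
      ∣U∣≤B (.x , x∈I , inj₁ refl) = ≤-trans (p⊆q⇒∣p∣≤∣q∣ U⊆∅) (≤-trans (≤-reflexive (∣⊥∣≡0 n)) z≤n)
        where
        U⊆∅ : U ⊆ ∅
        U⊆∅ w∈U with ∈⟦⟧⁻ fresh? w∈U
        ... | xw , w-undominated = contradiction (x , x∈I , inj₂ xw) w-undominated
      ∣U∣≤B (y , y∈I , inj₂ yx) = ≤-pred (begin-strict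
        ∣ U ∣         ≤⟨ p⊆q⇒∣p∣≤∣q∣ U⊆Nx-y ⟩
        ∣ N x - y ∣   <⟨ x∈p⇒∣p-x∣<∣p∣ (∈N⁺ (Adj-sym yx)) ⟩
        ∣ N x ∣       ≡⟨ degree≡∣N∣ x ⟨
        degree G x    ≤⟨ degree≤1+B x ⟩
        suc B         ∎)
        where
        open ≤-Reasoning
        U⊆Nx-y : U ⊆ N x - y
        U⊆Nx-y {w} w∈U with ∈⟦⟧⁻ fresh? w∈U
        ... | xw , w-undominated = x∈p∧x≢y⇒x∈p-y (∈N⁺ xw)
                                     λ { refl → w-undominated (w , y∈I , inj₁ refl) }
      size : ∣ I ∪ U ∣ ≤ ∣ I ∣ + B
      size = ≤-trans (∣p∪q∣≤∣p∣+∣q∣ I U) (+-monoʳ-≤ ∣ I ∣ (∣U∣≤B x-dominated))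
      covers : Covers (I ∪ U) x
      covers (inj₁ refl) = Dominated-mono (p⊆p∪q U) x-dominated
      covers {w} (inj₂ xw) with dominated? I w
      ... | yes w-dominated   = Dominated-mono (p⊆p∪q U) w-dominated
      ... | no  w-undominated =
        w , q⊆p∪q I U (∈⟦⟧⁺ fresh? (xw , w-undominated)) , inj₁ refl

    extend-over : ∀ T → Acc _⊂_ T → ∀ I → IsIndependent G I →
      ∃ λ I′ → I ⊆ I′ × IsIndependent G I′ × ∣ I′ ∣ ≤ ∣ I ∣ + B * ∣ T ∣ ×
               (∀ {x} → x ∈ T → Covers I′ x)
    extend-over T (acc rs) I I-ind with nonempty? T
    ... | no T-empty = I , ⊆-refl , I-ind , m≤m+n ∣ I ∣ _ , λ x∈T → contradiction (_ , x∈T) T-empty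
    ... | yes (x , x∈T)
      with I₁ , I⊆I₁ , I₁-ind , ∣I₁∣≤ , I₁-covers-x ← extend-at x I I-ind
      with I₂ , I₁⊆I₂ , I₂-ind , ∣I₂∣≤ , I₂-covers ← extend-over (T - x) (rs (x∈p⇒p-x⊂p x∈T)) I₁ I₁-ind
      = I₂ , ⊆-trans I⊆I₁ I₁⊆I₂ , I₂-ind , size , covers
      where
      size : ∣ I₂ ∣ ≤ ∣ I ∣ + B * ∣ T ∣
      size = begin
        ∣ I₂ ∣                      ≤⟨ ∣I₂∣≤ ⟩
        ∣ I₁ ∣ + B * ∣ T - x ∣      ≤⟨ +-monoˡ-≤ (B * ∣ T - x ∣) ∣I₁∣≤ ⟩
        ∣ I ∣ + B + B * ∣ T - x ∣   ≡⟨ +-assoc ∣ I ∣ B _ ⟩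
        ∣ I ∣ + (B + B * ∣ T - x ∣) ≡⟨ cong (∣ I ∣ +_) (*-suc B _) ⟨
        ∣ I ∣ + B * suc ∣ T - x ∣   ≤⟨ +-monoʳ-≤ ∣ I ∣ (*-monoʳ-≤ B (x∈p⇒∣p-x∣<∣p∣ x∈T)) ⟩
        ∣ I ∣ + B * ∣ T ∣           ∎
        where open ≤-Reasoning
      covers : ∀ {y} → y ∈ T → Covers I₂ y
      covers {y} y∈T with y ≟ x
      ... | yes refl = Dominated-mono I₁⊆I₂ ∘ I₁-covers-x
      ... | no  y≢x  = I₂-covers (x∈p∧x≢y⇒x∈p-y y∈T y≢x)

    extend-to-independent-dominating : ∀ {D S} → IsDominating G D → IsIndependent G S →
      ∃ λ I → IsDominating G I × IsIndependent G I × ∣ I ∣ ≤ ∣ S ∣ + B * ∣ D ─ S ∣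
    extend-to-independent-dominating {D} {S} D-dom S-ind
      with I , S⊆I , I-ind , size , covers ← extend-over (D ─ S) (⊂-wellFounded _) S S-ind
      = I , dominated⇒dominating dominated , I-ind , size
      where
      dominated : ∀ w → Dominated I w
      dominated w with dominating⇒dominated D-dom w
      ... | v , v∈D , w∈N[v] with v ∈? S
      ...   | yes v∈S = v , S⊆I v∈S , w∈N[v]
      ...   | no  v∉S = covers (x∈p∧x∉q⇒x∈p─q v∈D v∉S) w∈N[v]

  -- Forests

  NonBacktrackingWalk : (ℕ → Fin n) → Set
  NonBacktrackingWalk x = (∀ k → Adj G (x k) (x (suc k))) × (∀ k → x (suc (suc k)) ≢ x k)

  closed-walk⇒cycle : ∀ (x : ℕ → Fin n) l → (∀ k → Adj G (x k) (x (suc k))) →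
    x (3 + l) ≡ x 0 → (∀ {a b} → a < b → b ≤ 2 + l → x a ≢ x b) → HasCycle G
  closed-walk⇒cycle x l walk closed distinct = l , c , c-injective , c-path , c-closed
    where
    c : Fin (3 + l) → Fin n
    c t = x (toℕ t)
    c-injective : ∀ {s t} → c s ≡ c t → s ≡ t
    c-injective {s} {t} cs≡ct with <-cmp (toℕ s) (toℕ t)
    ... | tri< s<t _ _ = contradiction cs≡ct (distinct s<t (≤-pred (toℕ<n t)))
    ... | tri≈ _ s≡t _ = toℕ-injective s≡t
    ... | tri> _ _ t<s = contradiction (sym cs≡ct) (distinct t<s (≤-pred (toℕ<n s)))
    c-path : ∀ (t : Fin (2 + l)) → Adj G (c (inject₁ t)) (c (suc t))
    c-path t = subst (λ a → Adj G (x a) (x (suc (toℕ t)))) (sym (toℕ-inject₁ t)) (walk (toℕ t))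
    c-closed : Adj G (c (fromℕ (2 + l))) (c zero)
    c-closed = subst₂ (λ a b → Adj G (x a) b) (sym (toℕ-fromℕ (2 + l))) closed (walk (2 + l))

  module _ (acyclic : ¬ HasCycle G) where

    -- A first repetition x a ≡ x (1 + k) closes the cycle x a, …, x k, whose length is at
    -- least 3 because the walk neither stays put nor backtracks.
    non-backtracking⇒distinct : ∀ {x} → NonBacktrackingWalk x →
      ∀ k {a b} → a < b → b ≤ k → x a ≢ x b
    non-backtracking⇒distinct walk zero a<b z≤n = contradiction a<b λ ()
    non-backtracking⇒distinct {x} (walk , non-backtracking) (suc k) {a} {b} a<b b≤1+k xa≡xb
      with m≤n⇒m<n∨m≡n b≤1+k
    ... | inj₁ b<1+k = non-backtracking⇒distinct (walk , non-backtracking) k a<b (≤-pred b<1+k) xa≡xb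
    ... | inj₂ refl with m≤n⇒∃[o]m+o≡n (≤-pred a<b)
    ...   | zero , a+0≡k =
      Adj⇒≢ (walk a) (trans xa≡xb (cong (x ∘ suc) (trans (sym a+0≡k) (+-identityʳ a))))
    ...   | suc zero , a+1≡k =
      non-backtracking a (trans (cong (x ∘ suc) (trans (+-comm 1 a) a+1≡k)) (sym xa≡xb))
    ...   | suc (suc l) , a+[2+l]≡k = acyclic (closed-walk⇒cycle x′ l x′-walk x′-closed x′-distinct)
      where
      x′ : ℕ → Fin n
      x′ j = x (a + j)
      x′-walk : ∀ j → Adj G (x′ j) (x′ (suc j))
      x′-walk j = subst (λ m → Adj G (x′ j) (x m)) (sym (+-suc a j)) (walk (a + j))
      x′-closed : x′ (3 + l) ≡ x′ 0
      x′-closed = trans (cong x (trans (+-suc a (2 + l)) (cong suc a+[2+l]≡k)))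
                        (trans (sym xa≡xb) (cong x (sym (+-identityʳ a))))
      x′-distinct : ∀ {i j} → i < j → j ≤ 2 + l → x′ i ≢ x′ j
      x′-distinct i<j j≤2+l = non-backtracking⇒distinct (walk , non-backtracking) k
                               (+-monoʳ-< a i<j) (subst (a + _ ≤_) a+[2+l]≡k (+-monoʳ-≤ a j≤2+l))

    no-non-backtracking-walk : ∀ x → ¬ NonBacktrackingWalk x
    no-non-backtracking-walk x walk
      with i , j , i<j , xi≡xj ← pigeonhole (n<1+n n) (λ (t : Fin (suc n)) → x (toℕ t))
      = non-backtracking⇒distinct walk n i<j (≤-pred (toℕ<n j)) xi≡xj

    sparse-vertex : ∀ {X} → Nonempty X → ∃ λ v → v ∈ X × ∣ X ∩ N v ∣ ≤ 1
    sparse-vertex {X} (v₀ , v₀∈X) with any? (λ v → v ∈? X ×-dec ∣ X ∩ N v ∣ ≤? 1)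
    ... | yes sparse = sparse
    -- Otherwise every vertex of X has two neighbours in X, so a walk inside X never has to
    -- backtrack; its state is the last arc traversed.
    ... | no  none   = ⊥-elim (no-non-backtracking-walk x (walk , non-backtracking))
      where
      branching : ∀ {v} → v ∈ X → ∀ y → ∃ λ w → w ∈ X × Adj G v w × w ≢ y
      branching {v} v∈X y
        with w , w∈X∩Nv , w≢y ← 1<∣p∣⇒element≢ (≰⇒> λ ≤1 → none (v , v∈X , ≤1)) y
        = w , proj₁ (x∈p∩q⁻ X (N v) w∈X∩Nv) , ∈N⁻ (proj₂ (x∈p∩q⁻ X (N v) w∈X∩Nv)) , w≢y
      Arc : Set
      Arc = Σ (Fin n) λ a → Σ (Fin n) λ b → b ∈ X × Adj G a b
      next : Arc → Arc
      next (a , b , b∈X , _) = let (c , c∈X , bc , _) = branching b∈X a in b , c , c∈X , bc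
      arcs : ℕ → Arc
      arcs zero    = let (c , c∈X , v₀c , _) = branching v₀∈X v₀ in v₀ , c , c∈X , v₀c
      arcs (suc k) = next (arcs k)
      x : ℕ → Fin n
      x k = proj₁ (arcs k)
      walk : ∀ k → Adj G (x k) (x (suc k))
      walk k = proj₂ (proj₂ (proj₂ (arcs k)))
      non-backtracking : ∀ k → x (suc (suc k)) ≢ x k
      non-backtracking k = proj₂ (proj₂ (proj₂ (branching (proj₁ (proj₂ (proj₂ (arcs k)))) (x k))))

    large-independent-subset : ∀ X → Acc _⊂_ X →
      ∃ λ S → S ⊆ X × IsIndependent G S × ∣ X ∣ ≤ 2 * ∣ S ∣
    large-independent-subset X (acc rs) with nonempty? X
    ... | no X-empty =
      ∅ , (λ x∈∅ → contradiction x∈∅ ∉⊥) , independent-∅ ,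
      ≤-trans (≤-reflexive (trans (cong ∣_∣ (Empty-unique X-empty)) (∣⊥∣≡0 n))) z≤n
    ... | yes X-nonempty
      with v , v∈X , ∣X∩Nv∣≤1 ← sparse-vertex X-nonempty
      with S′ , S′⊆X′ , S′-ind , ∣X′∣≤ ← large-independent-subset (X ─ (⁅ v ⁆ ∪ N v))
             (rs (p∩q≢∅⇒p─q⊂p X (⁅ v ⁆ ∪ N v) (v , x∈p∩q⁺ (v∈X , p⊆p∪q (N v) (x∈⁅x⁆ v)))))
      = S′ ∪ ⁅ v ⁆ , S⊆X , S-ind , size
      where
      X′ : Subset n
      X′ = X ─ (⁅ v ⁆ ∪ N v)
      v∉X′ : v ∉ X′
      v∉X′ v∈X′ = x∈p─q⇒x∉q X (⁅ v ⁆ ∪ N v) v∈X′ (p⊆p∪q (N v) (x∈⁅x⁆ v))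
      S⊆X : S′ ∪ ⁅ v ⁆ ⊆ X
      S⊆X {w} w∈S with x∈p∪q⁻ S′ ⁅ v ⁆ w∈S
      ... | inj₁ w∈S′ = p─q⊆p X _ (S′⊆X′ w∈S′)
      ... | inj₂ w∈⁅v⁆ rewrite x∈⁅y⁆⇒x≡y v w∈⁅v⁆ = v∈X
      S-ind : IsIndependent G (S′ ∪ ⁅ v ⁆)
      S-ind = independent-∪ S′-ind (independent-⁅⁆ v) λ a b a∈S′ b∈⁅v⁆ ab →
        x∈p─q⇒x∉q X (⁅ v ⁆ ∪ N v) (S′⊆X′ a∈S′)
          (q⊆p∪q ⁅ v ⁆ (N v) (∈N⁺ (Adj-sym (subst (Adj G a) (x∈⁅y⁆⇒x≡y v b∈⁅v⁆) ab))))
      X⊆X′∪⁅v⁆∪[X∩Nv] : X ⊆ X′ ∪ (⁅ v ⁆ ∪ (X ∩ N v))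
      X⊆X′∪⁅v⁆∪[X∩Nv] {w} w∈X with w ≟ v | adj? v w
      ... | yes refl | _      = q⊆p∪q X′ _ (p⊆p∪q (X ∩ N v) (x∈⁅x⁆ v))
      ... | no  _    | yes vw = q⊆p∪q X′ _ (q⊆p∪q ⁅ v ⁆ (X ∩ N v) (x∈p∩q⁺ (w∈X , ∈N⁺ vw)))
      ... | no  w≢v  | no ¬vw = p⊆p∪q _ (x∈p∧x∉q⇒x∈p─q w∈X w∉⁅v⁆∪Nv)
        where
        w∉⁅v⁆∪Nv : w ∉ ⁅ v ⁆ ∪ N v
        w∉⁅v⁆∪Nv w∈ with x∈p∪q⁻ ⁅ v ⁆ (N v) w∈
        ... | inj₁ w∈⁅v⁆ = w≢v (x∈⁅y⁆⇒x≡y v w∈⁅v⁆)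
        ... | inj₂ w∈Nv  = ¬vw (∈N⁻ w∈Nv)
      size : ∣ X ∣ ≤ 2 * ∣ S′ ∪ ⁅ v ⁆ ∣
      size = begin
        ∣ X ∣                                 ≤⟨ p⊆q⇒∣p∣≤∣q∣ X⊆X′∪⁅v⁆∪[X∩Nv] ⟩
        ∣ X′ ∪ (⁅ v ⁆ ∪ (X ∩ N v)) ∣          ≤⟨ ∣p∪q∣≤∣p∣+∣q∣ X′ _ ⟩
        ∣ X′ ∣ + ∣ ⁅ v ⁆ ∪ (X ∩ N v) ∣        ≤⟨ +-monoʳ-≤ ∣ X′ ∣ (∣p∪q∣≤∣p∣+∣q∣ ⁅ v ⁆ (X ∩ N v)) ⟩
        ∣ X′ ∣ + (∣ ⁅ v ⁆ ∣ + ∣ X ∩ N v ∣)    ≤⟨ +-mono-≤ ∣X′∣≤ (+-mono-≤ (≤-reflexive (∣⁅x⁆∣≡1 v))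
                                                                         ∣X∩Nv∣≤1) ⟩
        2 * ∣ S′ ∣ + 2                        ≡⟨ +-comm (2 * ∣ S′ ∣) 2 ⟩
        2 + 2 * ∣ S′ ∣                        ≡⟨ *-suc 2 ∣ S′ ∣ ⟨
        2 * suc ∣ S′ ∣                        ≤⟨ *-monoʳ-≤ 2 (p⊂q⇒∣p∣<∣q∣ S′⊂S) ⟩
        2 * ∣ S′ ∪ ⁅ v ⁆ ∣                    ∎
        where
        open ≤-Reasoning
        S′⊂S : S′ ⊂ S′ ∪ ⁅ v ⁆
        S′⊂S = p⊆p∪q ⁅ v ⁆ , v , q⊆p∪q S′ ⁅ v ⁆ (x∈⁅x⁆ v) , v∉X′ ∘ S′⊆X′

  -- Balanced double stars

  walk-preserves : (C : Fin n → Set) → (∀ {s t} → C s → Adj G s t → C t) →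
    ∀ {s t} → Walk G s t → C s → C t
  walk-preserves C closed here           Cs = Cs
  walk-preserves C closed (step st walk) Cs = walk-preserves C closed walk (closed Cs st)

  module DoubleStar (connected : Connected G) (triangle-free : TriangleFree)
                    {a b : Fin n} (a≢b : a ≢ b)
                    (centres : ∀ w → 1 < degree G w → w ≡ a ⊎ w ≡ b) where

    leaf-degree : ∀ {w} → w ≢ a → w ≢ b → degree G w ≤ 1
    leaf-degree w≢a w≢b = ≮⇒≥ λ 1<degree → [ w≢a , w≢b ]′ (centres _ 1<degree)

    leaf-neighbour-unique : ∀ {w s t} → w ≢ a → w ≢ b → Adj G w s → Adj G w t → s ≡ t
    leaf-neighbour-unique w≢a w≢b = degree≤1⇒neighbours-equal (leaf-degree w≢a w≢b)

    centres-adjacent : Adj G a b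
    centres-adjacent with adj? a b
    ... | yes ab = ab
    ... | no ¬ab with walk-preserves (_∈N[ a ]) closed (connected a b) (inj₁ refl)
      where
      closed : ∀ {s t} → s ∈N[ a ] → Adj G s t → t ∈N[ a ]
      closed (inj₁ refl) st = inj₂ st
      closed (inj₂ as)   st = inj₁ (leaf-neighbour-unique (Adj⇒≢ as ∘ sym)
                                      (λ { refl → ¬ab as }) st (Adj-sym as))
    ...   | inj₁ b≡a = contradiction (sym b≡a) a≢b
    ...   | inj₂ ab  = contradiction ab ¬ab

    near-centres : ∀ w → w ∈N[ a ] ⊎ w ∈N[ b ]
    near-centres w = walk-preserves _ closed (connected a w) (inj₁ (inj₁ refl))
      where
      closed : ∀ {s t} → s ∈N[ a ] ⊎ s ∈N[ b ] → Adj G s t → t ∈N[ a ] ⊎ t ∈N[ b ]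
      closed (inj₁ (inj₁ refl)) st = inj₁ (inj₂ st)
      closed (inj₂ (inj₁ refl)) st = inj₂ (inj₂ st)
      closed {s} (inj₁ (inj₂ as)) st with s ≟ b
      ... | yes refl = inj₂ (inj₂ st)
      ... | no  s≢b  = inj₁ (inj₁ (leaf-neighbour-unique (Adj⇒≢ as ∘ sym) s≢b st (Adj-sym as)))
      closed {s} (inj₂ (inj₂ bs)) st with s ≟ a
      ... | yes refl = inj₁ (inj₂ st)
      ... | no  s≢a  = inj₂ (inj₁ (leaf-neighbour-unique s≢a (Adj⇒≢ bs ∘ sym) st (Adj-sym bs)))

    leaf-dominated : ∀ {c ℓ Y} → Adj G c ℓ → ℓ ≢ a → ℓ ≢ b → Dominated Y ℓ → ℓ ∈ Y ⊎ c ∈ Y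
    leaf-dominated cℓ ℓ≢a ℓ≢b (y , y∈Y , inj₁ refl) = inj₁ y∈Y
    leaf-dominated cℓ ℓ≢a ℓ≢b (y , y∈Y , inj₂ yℓ)
      rewrite leaf-neighbour-unique ℓ≢a ℓ≢b (Adj-sym yℓ) (Adj-sym cℓ) = inj₂ y∈Y

    2≤∣dominating∣ : 1 < degree G a → 1 < degree G b → ∀ {Y} → IsDominating G Y → 2 ≤ ∣ Y ∣
    2≤∣dominating∣ 1<deg-a 1<deg-b {Y} Y-dom
      with ℓa , aℓa , ℓa≢b ← 1<degree⇒neighbour≢ 1<deg-a b
      with ℓb , bℓb , ℓb≢a ← 1<degree⇒neighbour≢ 1<deg-b a
      with leaf-dominated aℓa (Adj⇒≢ aℓa ∘ sym) ℓa≢b (dominating⇒dominated Y-dom ℓa)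
         | leaf-dominated bℓb ℓb≢a (Adj⇒≢ bℓb ∘ sym) (dominating⇒dominated Y-dom ℓb)
    ... | inj₁ ℓa∈Y | inj₁ ℓb∈Y = two-elements⇒2≤∣p∣ ℓa∈Y ℓb∈Y
                                    λ { refl → triangle-free centres-adjacent bℓb (Adj-sym aℓa) }
    ... | inj₁ ℓa∈Y | inj₂ b∈Y  = two-elements⇒2≤∣p∣ ℓa∈Y b∈Y ℓa≢b
    ... | inj₂ a∈Y  | inj₁ ℓb∈Y = two-elements⇒2≤∣p∣ a∈Y ℓb∈Y (ℓb≢a ∘ sym)
    ... | inj₂ a∈Y  | inj₂ b∈Y  = two-elements⇒2≤∣p∣ a∈Y b∈Y a≢b

    degree≤∣dominating∣ : ∀ {Y} → IsDominating G Y → b ∉ Y → degree G b ≤ ∣ Y ∣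
    degree≤∣dominating∣ {Y} Y-dom b∉Y
      with z , z∈Y , a∈N[z] ← dominating⇒dominated Y-dom a
      = begin
        degree G b      ≡⟨ degree≡∣N∣ b ⟩
        ∣ N b ∣         ≤⟨ ∣p∣≤1+∣p-x∣ (N b) a ⟩
        suc ∣ N b - a ∣ ≤⟨ p⊂q⇒∣p∣<∣q∣ (leaves⊆Y , z , z∈Y , z∉leaves a∈N[z]) ⟩
        ∣ Y ∣           ∎
      where
      open ≤-Reasoning
      leaves⊆Y : N b - a ⊆ Y
      leaves⊆Y {ℓ} ℓ∈ with p─q⊆p (N b) ⁅ a ⁆ ℓ∈ | x∈p-y⇒x≢y (N b) ℓ∈
      ... | ℓ∈Nb | ℓ≢a with leaf-dominated (∈N⁻ ℓ∈Nb) ℓ≢a (Adj⇒≢ (∈N⁻ ℓ∈Nb) ∘ sym)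
                              (dominating⇒dominated Y-dom ℓ)
      ...   | inj₁ ℓ∈Y = ℓ∈Y
      ...   | inj₂ b∈Y = contradiction b∈Y b∉Y
      z∉leaves : a ∈N[ z ] → z ∉ N b - a
      z∉leaves a∈N[z] z∈ with p─q⊆p (N b) ⁅ a ⁆ z∈ | x∈p-y⇒x≢y (N b) z∈
      z∉leaves (inj₁ refl) z∈ | _    | z≢a = z≢a refl
      z∉leaves (inj₂ za)   z∈ | z∈Nb | _   = triangle-free centres-adjacent (∈N⁻ z∈Nb) za

    centres-dominating : IsDominating G (⁅ a ⁆ ∪ ⁅ b ⁆)
    centres-dominating = dominated⇒dominating λ w →
      [ (λ w∈N[a] → a , p⊆p∪q ⁅ b ⁆ (x∈⁅x⁆ a) , w∈N[a])
      , (λ w∈N[b] → b , q⊆p∪q ⁅ a ⁆ ⁅ b ⁆ (x∈⁅x⁆ b) , w∈N[b]) ]′ (near-centres w)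

    centre∪leaves-independent-dominating :
      IsDominating G (⁅ a ⁆ ∪ (N b - a)) × IsIndependent G (⁅ a ⁆ ∪ (N b - a)) ×
      ∣ ⁅ a ⁆ ∪ (N b - a) ∣ ≤ degree G b
    centre∪leaves-independent-dominating = dominated⇒dominating dominated , independent , size
      where
      dominated : ∀ w → Dominated (⁅ a ⁆ ∪ (N b - a)) w
      dominated w with near-centres w
      ... | inj₁ w∈N[a]       = a , p⊆p∪q (N b - a) (x∈⁅x⁆ a) , w∈N[a]
      ... | inj₂ (inj₁ refl)  = a , p⊆p∪q (N b - a) (x∈⁅x⁆ a) , inj₂ centres-adjacent
      ... | inj₂ (inj₂ bw) with w ≟ a
      ...   | yes refl = a , p⊆p∪q (N b - a) (x∈⁅x⁆ a) , inj₁ refl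
      ...   | no  w≢a  = w , q⊆p∪q ⁅ a ⁆ (N b - a) (x∈p∧x≢y⇒x∈p-y (∈N⁺ bw) w≢a) , inj₁ refl
      independent : IsIndependent G (⁅ a ⁆ ∪ (N b - a))
      independent = independent-∪ (independent-⁅⁆ a) leaves-independent λ s ℓ s∈⁅a⁆ ℓ∈ sℓ →
        triangle-free (subst (λ s → Adj G s ℓ) (x∈⁅y⁆⇒x≡y a s∈⁅a⁆) sℓ)
                      (Adj-sym (∈N⁻ (p─q⊆p (N b) ⁅ a ⁆ ℓ∈))) (Adj-sym centres-adjacent)
        where
        leaves-independent : IsIndependent G (N b - a)
        leaves-independent ℓ ℓ′ ℓ∈ ℓ′∈ ℓℓ′ =
          triangle-free (∈N⁻ (p─q⊆p (N b) ⁅ a ⁆ ℓ∈)) ℓℓ′ (Adj-sym (∈N⁻ (p─q⊆p (N b) ⁅ a ⁆ ℓ′∈)))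
      size : ∣ ⁅ a ⁆ ∪ (N b - a) ∣ ≤ degree G b
      size = begin
        ∣ ⁅ a ⁆ ∪ (N b - a) ∣     ≤⟨ ∣p∪q∣≤∣p∣+∣q∣ ⁅ a ⁆ (N b - a) ⟩
        ∣ ⁅ a ⁆ ∣ + ∣ N b - a ∣   ≡⟨ cong (_+ ∣ N b - a ∣) (∣⁅x⁆∣≡1 a) ⟩
        suc ∣ N b - a ∣           ≤⟨ x∈p⇒∣p-x∣<∣p∣ (∈N⁺ (Adj-sym centres-adjacent)) ⟩
        ∣ N b ∣                   ≡⟨ degree≡∣N∣ b ⟨
        degree G b                ∎
        where open ≤-Reasoning

  module _ {γ i : ℕ} (γ-number : IsDominationNumber G γ)
           (i-number : IsIndependentDominationNumber G i) where

    γ≤i : γ ≤ i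
    γ≤i with I , I-dom , _ , ∣I∣≡i ← proj₁ i-number = subst (γ ≤_) ∣I∣≡i (proj₂ γ-number I I-dom)

    i≤∣S∣+B*∣D─S∣ : TriangleFree → ∀ {B} → 1 ≤ B → (∀ v → degree G v ≤ suc B) →
      ∀ {D S} → IsDominating G D → IsIndependent G S → i ≤ ∣ S ∣ + B * ∣ D ─ S ∣
    i≤∣S∣+B*∣D─S∣ triangle-free 1≤B degree≤1+B D-dom S-ind
      with J , J-dom , J-ind , ∣J∣≤
             ← extend-to-independent-dominating triangle-free 1≤B degree≤1+B D-dom S-ind
      = ≤-trans (proj₂ i-number J J-dom J-ind) ∣J∣≤

    maxDegree≤2⇒i≤γ : TriangleFree → maxDegree G ≤ 2 → i ≤ γ
    maxDegree≤2⇒i≤γ triangle-free Δ≤2 with D , D-dom , ∣D∣≡γ ← proj₁ γ-number = begin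
      i                         ≤⟨ i≤∣S∣+B*∣D─S∣ triangle-free ≤-refl
                                     (λ v → ≤-trans (degree≤maxDegree v) Δ≤2) D-dom (independent-∅) ⟩
      ∣ ∅ {n} ∣ + 1 * ∣ D ─ ∅ ∣ ≡⟨ cong₂ _+_ (∣⊥∣≡0 n) (+-identityʳ ∣ D ─ ∅ ∣) ⟩
      ∣ D ─ ∅ ∣                 ≡⟨ cong ∣_∣ (p─⊥≡p D) ⟩
      ∣ D ∣                     ≡⟨ ∣D∣≡γ ⟩
      γ                         ∎
      where open ≤-Reasoning

    3≤maxDegree⇒2i≤Δγ : ¬ HasCycle G → 3 ≤ maxDegree G → 2 * i ≤ maxDegree G * γ
    3≤maxDegree⇒2i≤Δγ acyclic 3≤Δ
      with D , D-dom , ∣D∣≡γ ← proj₁ γ-number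
      with S , S⊆D , S-ind , ∣D∣≤2∣S∣ ← large-independent-subset acyclic D (⊂-wellFounded D)
      = begin
        2 * i                                       ≤⟨ *-monoʳ-≤ 2 i≤ ⟩
        2 * (∣ S ∣ + (Δ ∸ 1) * ∣ D ─ S ∣)           ≤⟨ 2*[s+[Δ∸1]*t]≤Δ*[s+t] 2≤Δ t≤s ⟩
        Δ * (∣ S ∣ + ∣ D ─ S ∣)                     ≡⟨ cong (Δ *_) (trans (sym ∣D∣≡s+t) ∣D∣≡γ) ⟩
        Δ * γ                                       ∎
      where
      open ≤-Reasoning
      Δ : ℕ
      Δ = maxDegree G
      2≤Δ : 2 ≤ Δ
      2≤Δ = <⇒≤ 3≤Δ
      i≤ : i ≤ ∣ S ∣ + (Δ ∸ 1) * ∣ D ─ S ∣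
      i≤ = i≤∣S∣+B*∣D─S∣ (acyclic⇒triangle-free acyclic) (∸-monoˡ-≤ 1 2≤Δ)
             (λ v → ≤-trans (degree≤maxDegree v) (m≤n+m∸n Δ 1)) D-dom S-ind
      ∣D∣≡s+t : ∣ D ∣ ≡ ∣ S ∣ + ∣ D ─ S ∣
      ∣D∣≡s+t = p⊆q⇒∣q∣≡∣p∣+∣q─p∣ S⊆D
      t≤s : ∣ D ─ S ∣ ≤ ∣ S ∣
      t≤s = +-cancelˡ-≤ ∣ S ∣ _ _ (begin
        ∣ S ∣ + ∣ D ─ S ∣  ≡⟨ ∣D∣≡s+t ⟨
        ∣ D ∣              ≤⟨ ∣D∣≤2∣S∣ ⟩
        2 * ∣ S ∣          ≡⟨ cong (∣ S ∣ +_) (+-identityʳ ∣ S ∣) ⟩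
        ∣ S ∣ + ∣ S ∣      ∎)

    balanced-double-star⇒i≡Δ×γ≡2 : Connected G → TriangleFree → IsBalancedDoubleStar G →
      i ≡ maxDegree G × γ ≡ 2
    balanced-double-star⇒i≡Δ×γ≡2 connected triangle-free
      (u , v , u≢v , 1<deg-u , 1<deg-v , deg-u≡deg-v , centres) = i≡Δ , γ≡2
      where
      module UV = DoubleStar connected triangle-free u≢v centres
      module VU = DoubleStar connected triangle-free (u≢v ∘ sym) (λ w → swap ∘ centres w)
      Δ≡deg-v : maxDegree G ≡ degree G v
      Δ≡deg-v = ≤-antisym (maxDegree≤ degree≤deg-v) (degree≤maxDegree v)
        where
        degree≤deg-v : ∀ w → degree G w ≤ degree G v
        degree≤deg-v w with w ≟ u | w ≟ v
        ... | yes refl | _        = ≤-reflexive deg-u≡deg-v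
        ... | no  _    | yes refl = ≤-refl
        ... | no  w≢u  | no  w≢v  = ≤-trans (UV.leaf-degree w≢u w≢v) (<⇒≤ 1<deg-v)
      γ≡2 : γ ≡ 2
      γ≡2 with D , D-dom , ∣D∣≡γ ← proj₁ γ-number =
        ≤-antisym γ≤2 (subst (2 ≤_) ∣D∣≡γ (UV.2≤∣dominating∣ 1<deg-u 1<deg-v D-dom))
        where
        γ≤2 : γ ≤ 2
        γ≤2 = ≤-trans (proj₂ γ-number _ UV.centres-dominating)
                (≤-trans (∣p∪q∣≤∣p∣+∣q∣ ⁅ u ⁆ ⁅ v ⁆) (≤-reflexive (cong₂ _+_ (∣⁅x⁆∣≡1 u) (∣⁅x⁆∣≡1 v))))
      i≡Δ : i ≡ maxDegree G
      i≡Δ with Y , Y-dom , Y-ind , ∣Y∣≡i ← proj₁ i-number =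
        trans (≤-antisym i≤deg-v (subst (degree G v ≤_) ∣Y∣≡i deg-v≤∣Y∣)) (sym Δ≡deg-v)
        where
        i≤deg-v : i ≤ degree G v
        i≤deg-v with J-dom , J-ind , ∣J∣≤ ← UV.centre∪leaves-independent-dominating =
          ≤-trans (proj₂ i-number _ J-dom J-ind) ∣J∣≤
        deg-v≤∣Y∣ : degree G v ≤ ∣ Y ∣
        deg-v≤∣Y∣ with v ∈? Y
        ... | no  v∉Y = UV.degree≤∣dominating∣ Y-dom v∉Y
        ... | yes v∈Y = subst (_≤ ∣ Y ∣) deg-u≡deg-v
                          (VU.degree≤∣dominating∣ Y-dom λ u∈Y → Y-ind u v u∈Y v∈Y UV.centres-adjacent)

theorem4 : ∀ {n : ℕ} (G : Graph n) → IsTree G → ∀ (γ i : ℕ) →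
    IsDominationNumber G γ → IsIndependentDominationNumber G i →
    ((maxDegree G ≤ 2 → i ≤ γ) ×
     (3 ≤ maxDegree G → 2 * i ≤ maxDegree G * γ)) ×
    ((maxDegree G ≤ 2 → i ≡ γ) ×
     (IsBalancedDoubleStar G → 2 * i ≡ maxDegree G * γ))
theorem4 G (_ , connected , acyclic) γ i γ-number i-number =
  (i≤γ , 3≤maxDegree⇒2i≤Δγ G γ-number i-number acyclic) ,
  (λ Δ≤2 → ≤-antisym (i≤γ Δ≤2) (γ≤i G γ-number i-number)) , 2i≡Δγ
  where
  triangle-free : TriangleFree G
  triangle-free = acyclic⇒triangle-free G acyclic
  i≤γ : maxDegree G ≤ 2 → i ≤ γ
  i≤γ = maxDegree≤2⇒i≤γ G γ-number i-number triangle-free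
  2i≡Δγ : IsBalancedDoubleStar G → 2 * i ≡ maxDegree G * γ
  2i≡Δγ double-star
    with i≡Δ , γ≡2 ← balanced-double-star⇒i≡Δ×γ≡2 G γ-number i-number connected triangle-free double-star
    rewrite i≡Δ | γ≡2 = *-comm 2 (maxDegree G)
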